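{- Let $A$ and $B$ be positive integers with $B \ge 4$ and $\sqrt{p_A} > B$, and suppose that for every integer $n > A$ the consecutive primes $p_{n-1}, p_n$ satisfy $\sqrt{p_n} - \sqrt{p_{n-1}} < B/2$. Then for every real number $x > p_A$ there is a prime number $p$ with $(x-1)^3 < p < x^3$.
   Context: $p_1 = 2 < p_2 = 3 < p_3 < \cdots$ denotes the increasing enumeration of all prime numbers, so $p_n$ is the $n$-th prime. -}

module Defs where

open import Level using (0ℓ)
open import Data.Nat as ℕ using (ℕ; zero; suc)
open import Data.Nat.Primality using (Prime; prime?)
open import Data.Integer using (+_)
open import Data.Rational using (ℚ; _<_; _≤_; _*_; _-_; _/_; 0ℚ; 1ℚ)
open import Data.Product using (Σ; ∃; _×_)
open import Data.Sum using (_⊎_)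
open import Data.Empty using (⊥)
open import Relation.Nullary using (does)
open import Data.Bool using (if_then_else_)

toℚ : ℕ → ℚ
toℚ n = + n / 1

primeCount : ℕ → ℕ
primeCount zero = zero
primeCount (suc m) = if does (prime? (suc m)) then suc (primeCount m) else primeCount m

-- p is the n-th prime p_n (p_1 = 2, p_2 = 3, ...)
IsNthPrime : ℕ → ℕ → Set
IsNthPrime n p = Prime p × primeCount p ≡ n
  where open import Relation.Binary.PropositionalEquality using (_≡_)

-- Real numbers as (two-sided, located) Dedekind cuts of ℚ.
-- L q means q < x, U q means x < q.
record ℝ : Set₁ where
  field
    L U        : ℚ → Set
    inhabitedL : ∃ L
    inhabitedU : ∃ U
    downL      : ∀ q r → q < r → L r → L q
    upU        : ∀ q r → q < r → U q → U r
    roundedL   : ∀ q → L q → Σ ℚ λ r → q < r × L r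
    roundedU   : ∀ r → U r → Σ ℚ λ q → q < r × U q
    disjoint   : ∀ q → L q → U q → ⊥
    located    : ∀ q r → q < r → L q ⊎ U r
open ℝ public

cube : ℚ → ℚ
cube q = q * q * q

_<ʳ_ : ℚ → ℝ → Set
r <ʳ x = L x r

-- r < x³   (cubing is strictly increasing on ℚ and on ℝ)
_<cubeOf_ : ℚ → ℝ → Set
r <cubeOf x = Σ ℚ λ q → L x q × r < cube q

cubeOfPred_<_ : ℝ → ℚ → Set
cubeOfPred x < r = Σ ℚ λ s → U x s × cube (s - 1ℚ) < r

-- √p - √q < c  for natural numbers p, q and rational c, expressed through
-- rational witnesses r < √q and s > √p with s - r < c.
SqrtDiffLt : ℕ → ℕ → ℚ → Set
SqrtDiffLt p q c =
  Σ ℚ λ r → Σ ℚ λ s →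
    (0ℚ ≤ r) × (r * r < toℚ q) × (0ℚ ≤ s) × (toℚ p < s * s) × (s - r < c)

{-# OPTIONS --safe #-}
-- Bracket x between quarter-integers, k/4 < x < (k+2)/4 with k ≥ 4 p_A. Then (x - 1)³ < ((k-2)/4)³
-- and (k/4)³ < x³, so it suffices to find a prime p with (k-2)³ < 64 p < k³. Let q be the largest
-- prime with 64 q ≤ (k-2)³ and p the next prime. Both come after p_A, so √p < √q + B/2, that is
-- p < q + B √q + B²/4; with B² < p_A ≤ k/4 and 64 q ≤ (k-2)³ this gives
-- 64 p < (k-2)³ + 4 k² + 4 k ≤ k³, which holds once k ≥ 8.
module Submission where

open import Defs
open import Data.Nat using (ℕ; _≤_; _<_; _*_; _∸_; suc)
open import Data.Nat.Primality using (Prime)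
open import Data.Integer using (+_)
open import Data.Rational using (_/_)
open import Data.Product using (Σ; _×_)

open import Data.Nat as ℕ using (zero; _+_; z≤n; s≤s; _≤′_; ≤′-refl; ≤′-step; _!)
import Data.Nat.Properties as ℕₚ
open import Data.Nat.DivMod using (m/n*n≤m; m≡m%n+[m/n]*n; m%n<n)
open import Data.Nat.Divisibility using (_∣_; ∣-trans; ∣1⇒≡1; ∣m+n∣m⇒∣n; m≤n⇒m!∣n!; m∣m*n)
open import Data.Nat.Primality using (prime?; ¬prime[0]; ¬prime[1]; prime⇒nonTrivial)
open import Data.Nat.Primality.Factorisation using (factorise)
open import Data.Nat.ListAction using (product)
open import Data.Nat.Solver using (module +-*-Solver)
import Data.Integer as ℤ
import Data.Integer.Properties as ℤₚ
open import Data.Rational as ℚ using (ℚ; mkℚ; 0ℚ; 1ℚ)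
import Data.Rational.Properties as ℚₚ
open import Data.Rational.Unnormalised as ℚᵘ using (mkℚᵘ)
import Data.Rational.Unnormalised.Properties as ℚᵘₚ
import Data.Rational.Solver as ℚ-Solver
open import Data.Integer.Solver using () renaming (module +-*-Solver to ℤ-Solver)
open import Data.Nat.Coprimality using (1-coprimeTo) renaming (sym to coprime-sym)
open import Data.List using ([]; _∷_)
open import Data.List.Relation.Unary.All using (_∷_)
open import Data.Product using (_,_)
open import Data.Sum using (inj₁; inj₂)
open import Data.Empty using (⊥-elim)
open import Relation.Nullary using (¬_; yes; no; contradiction)
open import Relation.Unary using (Pred; Decidable)
open import Relation.Binary.PropositionalEquality

private
  variable
    m n p q : ℕ

toℚᵘ-toℚ : ∀ n → ℚ.toℚᵘ (toℚ n) ≡ mkℚᵘ (+ n) 0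
toℚᵘ-toℚ n = cong ℚ.toℚᵘ (ℚₚ.normalize-coprime (coprime-sym (1-coprimeTo n)))

toℚ-+ : ∀ m n → toℚ (m + n) ≡ toℚ m ℚ.+ toℚ n
toℚ-+ m n = ℚₚ.toℚᵘ-injective (begin
  ℚ.toℚᵘ (toℚ (m + n))                 ≈⟨ ℚᵘₚ.≃-reflexive (toℚᵘ-toℚ (m + n)) ⟩
  mkℚᵘ (+ (m + n)) 0                   ≈⟨ ℚᵘ.*≡* (cong (ℤ._* + 1) (trans (ℤₚ.pos-+ m n)
                                            (sym (cong₂ ℤ._+_ (ℤₚ.*-identityʳ (+ m)) (ℤₚ.*-identityʳ (+ n)))))) ⟩
  mkℚᵘ (+ m) 0 ℚᵘ.+ mkℚᵘ (+ n) 0       ≈⟨ ℚᵘₚ.≃-reflexive (cong₂ ℚᵘ._+_ (toℚᵘ-toℚ m) (toℚᵘ-toℚ n)) ⟨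
  ℚ.toℚᵘ (toℚ m) ℚᵘ.+ ℚ.toℚᵘ (toℚ n)   ≈⟨ ℚₚ.toℚᵘ-homo-+ (toℚ m) (toℚ n) ⟨
  ℚ.toℚᵘ (toℚ m ℚ.+ toℚ n)             ∎)
  where open ℚᵘₚ.≃-Reasoning

toℚ-* : ∀ m n → toℚ (m * n) ≡ toℚ m ℚ.* toℚ n
toℚ-* m n = ℚₚ.toℚᵘ-injective (begin
  ℚ.toℚᵘ (toℚ (m * n))                 ≈⟨ ℚᵘₚ.≃-reflexive (toℚᵘ-toℚ (m * n)) ⟩
  mkℚᵘ (+ (m * n)) 0                   ≈⟨ ℚᵘ.*≡* (cong (ℤ._* + 1) (ℤₚ.pos-* m n)) ⟩
  mkℚᵘ (+ m) 0 ℚᵘ.* mkℚᵘ (+ n) 0       ≈⟨ ℚᵘₚ.≃-reflexive (cong₂ ℚᵘ._*_ (toℚᵘ-toℚ m) (toℚᵘ-toℚ n)) ⟨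
  ℚ.toℚᵘ (toℚ m) ℚᵘ.* ℚ.toℚᵘ (toℚ n)   ≈⟨ ℚₚ.toℚᵘ-homo-* (toℚ m) (toℚ n) ⟨
  ℚ.toℚᵘ (toℚ m ℚ.* toℚ n)             ∎)
  where open ℚᵘₚ.≃-Reasoning

toℚ-mono-≤ : m ≤ n → toℚ m ℚ.≤ toℚ n
toℚ-mono-≤ {m} {n} m≤n = ℚₚ.toℚᵘ-cancel-≤
  (subst₂ ℚᵘ._≤_ (sym (toℚᵘ-toℚ m)) (sym (toℚᵘ-toℚ n))
    (ℚᵘ.*≤* (subst₂ ℤ._≤_ (sym (ℤₚ.*-identityʳ (+ m))) (sym (ℤₚ.*-identityʳ (+ n))) (ℤ.+≤+ m≤n))))

toℚ-mono-< : m < n → toℚ m ℚ.< toℚ n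
toℚ-mono-< {m} {n} m<n = ℚₚ.toℚᵘ-cancel-<
  (subst₂ ℚᵘ._<_ (sym (toℚᵘ-toℚ m)) (sym (toℚᵘ-toℚ n))
    (ℚᵘ.*<* (subst₂ ℤ._<_ (sym (ℤₚ.*-identityʳ (+ m))) (sym (ℤₚ.*-identityʳ (+ n))) (ℤ.+<+ m<n))))

toℚ-cancel-< : toℚ m ℚ.< toℚ n → m < n
toℚ-cancel-< lt = ℕₚ.≰⇒> (λ n≤m → ℚₚ.<-irrefl refl (ℚₚ.<-≤-trans lt (toℚ-mono-≤ n≤m)))

0≤toℚ : ∀ n → 0ℚ ℚ.≤ toℚ n
0≤toℚ n = toℚ-mono-≤ {0} {n} z≤n

half+half : ∀ n → (+ n) / 2 ℚ.+ (+ n) / 2 ≡ toℚ n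
half+half n = ℚₚ.toℚᵘ-injective (begin
  ℚ.toℚᵘ ((+ n) / 2 ℚ.+ (+ n) / 2)             ≈⟨ ℚₚ.toℚᵘ-homo-+ ((+ n) / 2) ((+ n) / 2) ⟩
  ℚ.toℚᵘ ((+ n) / 2) ℚᵘ.+ ℚ.toℚᵘ ((+ n) / 2)  ≈⟨ ℚᵘₚ.+-cong half half ⟩
  mkℚᵘ (+ n) 1 ℚᵘ.+ mkℚᵘ (+ n) 1               ≈⟨ ℚᵘ.*≡* (solve 1 (λ b → (b :* con (+ 2) :+ b :* con (+ 2)) :* con (+ 1) := b :* con (+ 4)) refl (+ n)) ⟩
  mkℚᵘ (+ n) 0                                 ≈⟨ ℚᵘₚ.≃-reflexive (toℚᵘ-toℚ n) ⟨
  ℚ.toℚᵘ (toℚ n)                               ∎)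
  where
  open ℚᵘₚ.≃-Reasoning
  open ℤ-Solver
  half : ℚ.toℚᵘ ((+ n) / 2) ℚᵘ.≃ mkℚᵘ (+ n) 1
  half = ℚₚ.toℚᵘ-fromℚᵘ (mkℚᵘ (+ n) 1)

square-mono-≤ : ∀ {a b} → 0ℚ ℚ.≤ a → a ℚ.≤ b → a ℚ.* a ℚ.≤ b ℚ.* b
square-mono-≤ {a} {b} 0≤a a≤b = ℚₚ.≤-trans
  (ℚₚ.*-monoˡ-≤-nonNeg a {{ℚ.nonNegative 0≤a}} a≤b)
  (ℚₚ.*-monoʳ-≤-nonNeg b {{ℚ.nonNegative (ℚₚ.≤-trans 0≤a a≤b)}} a≤b)

square-cancel-< : ∀ {a b} → 0ℚ ℚ.≤ b → a ℚ.* a ℚ.< b ℚ.* b → a ℚ.< b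
square-cancel-< 0≤b a²<b² = ℚₚ.≰⇒> (λ b≤a → ℚₚ.<-irrefl refl (ℚₚ.<-≤-trans a²<b² (square-mono-≤ 0≤b b≤a)))

quarter : ℕ → ℚ
quarter k = (+ k) / 4

4*quarter : ∀ k → toℚ 4 ℚ.* quarter k ≡ toℚ k
4*quarter k = ℚₚ.toℚᵘ-injective (begin
  ℚ.toℚᵘ (toℚ 4 ℚ.* quarter k)                ≈⟨ ℚₚ.toℚᵘ-homo-* (toℚ 4) (quarter k) ⟩
  ℚ.toℚᵘ (toℚ 4) ℚᵘ.* ℚ.toℚᵘ (quarter k)      ≈⟨ ℚᵘₚ.*-congˡ {ℚ.toℚᵘ (toℚ 4)} (ℚₚ.toℚᵘ-fromℚᵘ (mkℚᵘ (+ k) 3)) ⟩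
  mkℚᵘ (+ 4) 0 ℚᵘ.* mkℚᵘ (+ k) 3              ≈⟨ ℚᵘ.*≡* (solve 1 (λ b → (con (+ 4) :* b) :* con (+ 1) := b :* con (+ 4)) refl (+ k)) ⟩
  mkℚᵘ (+ k) 0                                ≈⟨ ℚᵘₚ.≃-reflexive (toℚᵘ-toℚ k) ⟨
  ℚ.toℚᵘ (toℚ k)                              ∎)
  where
  open ℚᵘₚ.≃-Reasoning
  open ℤ-Solver

4*-injective : ∀ {a b} → toℚ 4 ℚ.* a ≡ toℚ 4 ℚ.* b → a ≡ b
4*-injective eq = ℚₚ.≤-antisym (ℚₚ.*-cancelˡ-≤-pos (toℚ 4) (ℚₚ.≤-reflexive eq))
                               (ℚₚ.*-cancelˡ-≤-pos (toℚ 4) (ℚₚ.≤-reflexive (sym eq)))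

quarter-4* : ∀ n → quarter (4 * n) ≡ toℚ n
quarter-4* n = 4*-injective (trans (4*quarter (4 * n)) (toℚ-* 4 n))

quarter-4+ : ∀ n → quarter (4 + n) ℚ.- 1ℚ ≡ quarter n
quarter-4+ n = 4*-injective (begin
  toℚ 4 ℚ.* (quarter (4 + n) ℚ.- 1ℚ)       ≡⟨ solve 2 (λ a y → a :* (y :- con 1ℚ) := a :* y :- a) refl (toℚ 4) (quarter (4 + n)) ⟩
  toℚ 4 ℚ.* quarter (4 + n) ℚ.- toℚ 4      ≡⟨ cong (ℚ._- toℚ 4) (trans (4*quarter (4 + n)) (toℚ-+ 4 n)) ⟩
  toℚ 4 ℚ.+ toℚ n ℚ.- toℚ 4                ≡⟨ solve 2 (λ a b → a :+ b :- a := b) refl (toℚ 4) (toℚ n) ⟩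
  toℚ n                                    ≡⟨ 4*quarter n ⟨
  toℚ 4 ℚ.* quarter n                      ∎)
  where open ≡-Reasoning; open ℚ-Solver.+-*-Solver

quarter-mono-< : m < n → quarter m ℚ.< quarter n
quarter-mono-< {m} {n} m<n =
  ℚₚ.*-cancelˡ-<-nonNeg (toℚ 4) (subst₂ ℚ._<_ (sym (4*quarter m)) (sym (4*quarter n)) (toℚ-mono-< m<n))

quarter-mono-≤ : m ≤ n → quarter m ℚ.≤ quarter n
quarter-mono-≤ {m} {n} m≤n =
  ℚₚ.*-cancelˡ-≤-pos (toℚ 4) (subst₂ ℚ._≤_ (sym (4*quarter m)) (sym (4*quarter n)) (toℚ-mono-≤ m≤n))

cubeℕ : ℕ → ℕ
cubeℕ n = n * n * n

64*cube-quarter : ∀ n → toℚ 64 ℚ.* cube (quarter n) ≡ toℚ (cubeℕ n)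
64*cube-quarter n = begin
  toℚ 64 ℚ.* cube (quarter n)                     ≡⟨ solve 2 (λ a y → (a :* a :* a) :* (y :* y :* y) := (a :* y) :* (a :* y) :* (a :* y)) refl (toℚ 4) (quarter n) ⟩
  cube (toℚ 4 ℚ.* quarter n)                      ≡⟨ cong cube (4*quarter n) ⟩
  toℚ n ℚ.* toℚ n ℚ.* toℚ n                       ≡⟨ cong (ℚ._* toℚ n) (toℚ-* n n) ⟨
  toℚ (n * n) ℚ.* toℚ n                           ≡⟨ toℚ-* (n * n) n ⟨
  toℚ (cubeℕ n)                                   ∎
  where open ≡-Reasoning; open ℚ-Solver.+-*-Solver

cube-quarter<toℚ : cubeℕ n < 64 * p → cube (quarter n) ℚ.< toℚ p
cube-quarter<toℚ {n} {p} n³<64p = ℚₚ.*-cancelˡ-<-nonNeg (toℚ 64)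
  (subst₂ ℚ._<_ (sym (64*cube-quarter n)) (toℚ-* 64 p) (toℚ-mono-< n³<64p))

toℚ<cube-quarter : 64 * p < cubeℕ n → toℚ p ℚ.< cube (quarter n)
toℚ<cube-quarter {p} {n} 64p<n³ = ℚₚ.*-cancelˡ-<-nonNeg (toℚ 64)
  (subst₂ ℚ._<_ (toℚ-* 64 p) (sym (64*cube-quarter n)) (toℚ-mono-< 64p<n³))

archimedean : ∀ r → Σ ℕ λ n → r ℚ.< toℚ n
archimedean r@(mkℚ ℤ.-[1+ _ ] _ _) = 1 , ℚₚ.toℚᵘ-cancel-<
  (subst (ℚᵘ._<_ (ℚ.toℚᵘ r)) (sym (toℚᵘ-toℚ 1)) (ℚᵘ.*<* ℤ.-<+))
archimedean r@(mkℚ (+ n) d _) = suc n , ℚₚ.toℚᵘ-cancel-<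
  (subst (ℚᵘ._<_ (ℚ.toℚᵘ r)) (sym (toℚᵘ-toℚ (suc n)))
    (ℚᵘ.*<* (subst₂ ℤ._<_ (sym (ℤₚ.*-identityʳ (+ n))) (ℤₚ.pos-* (suc n) (suc d))
      (ℤ.+<+ (ℕₚ.<-≤-trans (ℕₚ.n<1+n n) (ℕₚ.m≤m*n (suc n) (suc d)))))))

quarter-bracket : (x : ℝ) → quarter m <ʳ x →
  Σ ℕ λ k → m ≤ k × quarter k <ʳ x × U x (quarter (2 + k))
quarter-bracket {m} x m<x with inhabitedU x
... | r , x<r with archimedean r
... | M , r<M = walk (4 * M) m (ℕₚ.m≤n+m (4 * M) m) ℕₚ.≤-refl m<x
  where
  -- x < r < M = quarter (4 M), so the walk stops before k passes 4 M.
  walk : ∀ fuel k → 4 * M ≤ k + fuel → m ≤ k → quarter k <ʳ x →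
    Σ ℕ λ k → m ≤ k × quarter k <ʳ x × U x (quarter (2 + k))
  walk zero k 4M≤k _ k<x = ⊥-elim (disjoint x (quarter k) k<x (upU x r (quarter k) r<k x<r))
    where
    r<k : r ℚ.< quarter k
    r<k = ℚₚ.<-≤-trans (subst (r ℚ.<_) (sym (quarter-4* M)) r<M)
                       (quarter-mono-≤ {4 * M} (subst (4 * M ≤_) (ℕₚ.+-identityʳ k) 4M≤k))
  walk (suc fuel) k bound m≤k k<x with located x (quarter (1 + k)) (quarter (2 + k)) (quarter-mono-< {1 + k} ℕₚ.≤-refl)
  ... | inj₂ x<2+k = k , m≤k , k<x , x<2+k
  ... | inj₁ 1+k<x = walk fuel (1 + k) (subst (4 * M ≤_) (ℕₚ.+-suc k fuel) bound) (ℕₚ.m≤n⇒m≤1+n m≤k) 1+k<x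

cubes-around : (x : ℝ) → U x (quarter (4 + n)) → quarter (2 + n) <ʳ x →
  cubeℕ n < 64 * p → 64 * p < cubeℕ (2 + n) → (cubeOfPred x < toℚ p) × (toℚ p <cubeOf x)
cubes-around {n} {p} x x<4+n 2+n<x lower upper =
  (quarter (4 + n) , x<4+n , subst (λ s → cube s ℚ.< toℚ p) (sym (quarter-4+ n)) (cube-quarter<toℚ {n} {p} lower)) ,
  (quarter (2 + n) , 2+n<x , toℚ<cube-quarter {p} {2 + n} upper)

module _ {ℓ} {P : Pred ℕ ℓ} (P? : Decidable P) where

  first-from : m ≤ n → P n → Σ ℕ λ k → m ≤ k × P k × (∀ i → m ≤ i → i < k → ¬ P i)
  first-from {m} {n} m≤n Pn = search m (n ∸ m) (subst P (sym (ℕₚ.m+[n∸m]≡n m≤n)) Pn)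
    where
    search : ∀ m d → P (m + d) → Σ ℕ λ k → m ≤ k × P k × (∀ i → m ≤ i → i < k → ¬ P i)
    search m d Pm+d with P? m
    ... | yes Pm = m , ℕₚ.≤-refl , Pm , λ i m≤i i<m _ → ℕₚ.≤⇒≯ m≤i i<m
    search m zero    Pm   | no ¬Pm = contradiction (subst P (ℕₚ.+-identityʳ m) Pm) ¬Pm
    search m (suc d) Pm+d | no ¬Pm with search (suc m) d (subst P (ℕₚ.+-suc m d) Pm+d)
    ... | k , m<k , Pk , none = k , ℕₚ.<⇒≤ m<k , Pk , none′
      where
      none′ : ∀ i → m ≤ i → i < k → ¬ P i
      none′ i m≤i i<k with ℕₚ.m≤n⇒m<n∨m≡n m≤i
      ... | inj₁ m<i = none i m<i i<k
      ... | inj₂ refl = ¬Pm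

  last-upTo : m ≤ n → P m → Σ ℕ λ k → m ≤ k × k ≤ n × P k × (∀ i → k < i → i ≤ n → ¬ P i)
  last-upTo {m} m≤n Pm = search (ℕₚ.≤⇒≤′ m≤n)
    where
    search : ∀ {n} → m ≤′ n → Σ ℕ λ k → m ≤ k × k ≤ n × P k × (∀ i → k < i → i ≤ n → ¬ P i)
    search {n} m≤′n with P? n
    ... | yes Pn = n , ℕₚ.≤′⇒≤ m≤′n , ℕₚ.≤-refl , Pn , λ i n<i i≤n _ → ℕₚ.≤⇒≯ i≤n n<i
    search ≤′-refl            | no ¬Pm = contradiction Pm ¬Pm
    search (≤′-step {n} m≤′n) | no ¬P[1+n] with search m≤′n
    ... | k , m≤k , k≤n , Pk , none = k , m≤k , ℕₚ.m≤n⇒m≤1+n k≤n , Pk , none′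
      where
      none′ : ∀ i → k < i → i ≤ suc n → ¬ P i
      none′ i k<i i≤1+n with ℕₚ.m≤n⇒m<n∨m≡n i≤1+n
      ... | inj₁ i<1+n = none i k<i (ℕₚ.≤-pred i<1+n)
      ... | inj₂ refl = ¬P[1+n]

prime-factor : 2 ≤ n → Σ ℕ λ p → Prime p × p ∣ n
prime-factor {n@(suc _)} 2≤n with factorise n
... | record { factors = [] ; isFactorisation = n≡1 } = ⊥-elim (ℕₚ.<⇒≢ 2≤n (sym n≡1))
... | record { factors = p ∷ ps ; isFactorisation = n≡p*ps ; factorsPrime = prime-p ∷ _ } =
  p , prime-p , subst (p ∣_) (sym n≡p*ps) (m∣m*n (product ps))

prime-above : ∀ n → Σ ℕ λ p → Prime p × n < p
prime-above n with prime-factor (ℕₚ.+-monoˡ-≤ 1 (ℕₚ.1≤n! n))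
... | p , prime-p , p∣n!+1 with p ℕ.≤? n
... | no p≰n = p , prime-p , ℕₚ.≰⇒> p≰n
... | yes p≤n = contradiction (subst Prime (∣1⇒≡1 (∣m+n∣m⇒∣n p∣n!+1 p∣n!)) prime-p) ¬prime[1]
  where
  p∣p! : ∀ {p} → Prime p → p ∣ p !
  p∣p! {zero}  prime-0 = contradiction prime-0 ¬prime[0]
  p∣p! {suc p} _       = m∣m*n (p !)
  p∣n! : p ∣ n !
  p∣n! = ∣-trans (p∣p! prime-p) (m≤n⇒m!∣n! p≤n)

8≤4*prime : Prime p → 8 ≤ 4 * p
8≤4*prime {p} prime-p = ℕₚ.*-monoʳ-≤ 4 (ℕ.nonTrivial⇒n>1 p {{prime⇒nonTrivial prime-p}})

primeCount-suc-prime : Prime (suc n) → primeCount (suc n) ≡ suc (primeCount n)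
primeCount-suc-prime {n} prime-1+n with prime? (suc n)
... | yes _         = refl
... | no ¬prime-1+n = contradiction prime-1+n ¬prime-1+n

primeCount-suc-¬prime : ¬ Prime (suc n) → primeCount (suc n) ≡ primeCount n
primeCount-suc-¬prime {n} ¬prime-1+n with prime? (suc n)
... | yes prime-1+n = contradiction prime-1+n ¬prime-1+n
... | no _          = refl

primeCount-≤-suc : ∀ n → primeCount n ≤ primeCount (suc n)
primeCount-≤-suc n with prime? (suc n)
... | yes _ = ℕₚ.n≤1+n (primeCount n)
... | no _  = ℕₚ.≤-refl

primeCount-mono : m ≤ n → primeCount m ≤ primeCount n
primeCount-mono m≤n = go (ℕₚ.≤⇒≤′ m≤n)
  where
  go : m ≤′ n → primeCount m ≤ primeCount n
  go ≤′-refl            = ℕₚ.≤-refl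
  go (≤′-step {n} m≤′n) = ℕₚ.≤-trans (go m≤′n) (primeCount-≤-suc n)

primeCount-const : m ≤ n → (∀ i → m < i → i ≤ n → ¬ Prime i) → primeCount n ≡ primeCount m
primeCount-const m≤n = go (ℕₚ.≤⇒≤′ m≤n)
  where
  go : m ≤′ n → (∀ i → m < i → i ≤ n → ¬ Prime i) → primeCount n ≡ primeCount m
  go ≤′-refl            _    = refl
  go (≤′-step {n} m≤′n) none = trans
    (primeCount-suc-¬prime (none (suc n) (s≤s (ℕₚ.≤′⇒≤ m≤′n)) ℕₚ.≤-refl))
    (go m≤′n (λ i m<i i≤n → none i m<i (ℕₚ.m≤n⇒m≤1+n i≤n)))

primeCount-next : Prime p → q < p → (∀ i → q < i → i < p → ¬ Prime i) →
  primeCount p ≡ suc (primeCount q)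
primeCount-next prime-p (s≤s q≤p-1) none = trans (primeCount-suc-prime prime-p)
  (cong suc (primeCount-const q≤p-1 (λ i q<i i≤p-1 → none i q<i (s≤s i≤p-1))))

consecutive-primes-around : Prime m → m ≤ n →
  Σ ℕ λ q → Σ ℕ λ p → Prime q × Prime p × m ≤ q × q ≤ n × n < p × primeCount p ≡ suc (primeCount q)
consecutive-primes-around {m} {n} prime-m m≤n
  with last-upTo prime? m≤n prime-m | prime-above n
... | q , m≤q , q≤n , prime-q , none-above-q | r , prime-r , n<r
  with first-from prime? n<r prime-r
... | p , n<p , prime-p , none-below-p =
  q , p , prime-q , prime-p , m≤q , q≤n , n<p , primeCount-next prime-p (ℕₚ.≤-<-trans q≤n n<p) none-between
  where
  none-between : ∀ i → q < i → i < p → ¬ Prime i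
  none-between i q<i i<p with i ℕ.≤? n
  ... | yes i≤n = none-above-q i q<i i≤n
  ... | no i≰n  = none-below-p i (ℕₚ.≰⇒> i≰n) i<p

consecutive-primes-around-multiple : ∀ d .{{_ : ℕ.NonZero d}} {M} → Prime m → d * m ≤ M →
  Σ ℕ λ q → Σ ℕ λ p → Prime q × Prime p × m ≤ q × d * q ≤ M × M < d * p × primeCount p ≡ suc (primeCount q)
consecutive-primes-around-multiple {m} d {M} prime-m dm≤M =
  let q , p , prime-q , prime-p , m≤q , q≤N , N<p , p-after-q = consecutive-primes-around prime-m m≤N
  in  q , p , prime-q , prime-p , m≤q
    , ℕₚ.≤-trans (ℕₚ.*-monoʳ-≤ d q≤N) (subst (_≤ M) (ℕₚ.*-comm N d) (m/n*n≤m M d))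
    , ℕₚ.<-≤-trans M<d[1+N] (ℕₚ.*-monoʳ-≤ d N<p)
    , p-after-q
  where
  N : ℕ
  N = M ℕ./ d
  M<d[1+N] : M < d * suc N
  M<d[1+N] = subst₂ _<_ (sym (m≡m%n+[m/n]*n M d)) (ℕₚ.*-comm (suc N) d) (ℕₚ.+-monoˡ-< (N * d) (m%n<n M d))
  m≤N : m ≤ N
  m≤N = ℕₚ.≤-pred (ℕₚ.*-cancelˡ-< d m (suc N) (ℕₚ.≤-<-trans dm≤M M<d[1+N]))

-- p < (√q + B/2)² = q + B √q + B²/4, scaled by 16; the hypothesis bounds 16 B √q by K.
SqrtDiffLt⇒bound : ∀ {p q B K} → SqrtDiffLt p q ((+ B) / 2) → 256 * (B * B) * q < K * K →
  16 * p < 16 * q + K + 4 * (B * B)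
SqrtDiffLt⇒bound {p} {q} {B} {K} (r , s , _ , r²<q , 0≤s , p<s² , s-r<c) 256B²q<K² = toℚ-cancel-< (begin-strict
  toℚ (16 * p)                                         ≡⟨ toℚ-* 16 p ⟩
  toℚ 16 ℚ.* toℚ p                                     <⟨ ℚₚ.*-monoʳ-<-pos (toℚ 16) p<[r+c]² ⟩
  toℚ 16 ℚ.* ((r ℚ.+ c) ℚ.* (r ℚ.+ c))                 ≡⟨ expand ⟩
  toℚ 16 ℚ.* (r ℚ.* r) ℚ.+ toℚ 16 ℚ.* b ℚ.* r ℚ.+ toℚ 4 ℚ.* (b ℚ.* b)
    <⟨ ℚₚ.+-monoˡ-< (toℚ 4 ℚ.* (b ℚ.* b)) (ℚₚ.+-mono-< (ℚₚ.*-monoʳ-<-pos (toℚ 16) r²<q) 16br<K) ⟩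
  toℚ 16 ℚ.* toℚ q ℚ.+ toℚ K ℚ.+ toℚ 4 ℚ.* (b ℚ.* b)   ≡⟨ cast ⟨
  toℚ (16 * q + K + 4 * (B * B))                       ∎)
  where
  open ℚₚ.≤-Reasoning
  open ℚ-Solver.+-*-Solver
  b c : ℚ
  b = toℚ B
  c = (+ B) / 2

  p<[r+c]² : toℚ p ℚ.< (r ℚ.+ c) ℚ.* (r ℚ.+ c)
  p<[r+c]² = ℚₚ.<-≤-trans p<s² (square-mono-≤ 0≤s (ℚₚ.<⇒≤ s<r+c))
    where
    s<r+c : s ℚ.< r ℚ.+ c
    s<r+c = subst₂ ℚ._<_ (solve 2 (λ s r → (s :- r) :+ r := s) refl s r) (ℚₚ.+-comm c r) (ℚₚ.+-monoˡ-< r s-r<c)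

  expand : toℚ 16 ℚ.* ((r ℚ.+ c) ℚ.* (r ℚ.+ c)) ≡ toℚ 16 ℚ.* (r ℚ.* r) ℚ.+ toℚ 16 ℚ.* b ℚ.* r ℚ.+ toℚ 4 ℚ.* (b ℚ.* b)
  expand = trans
    (solve 2 (λ r c → con (toℚ 16) :* ((r :+ c) :* (r :+ c))
                   := con (toℚ 16) :* (r :* r) :+ con (toℚ 16) :* (c :+ c) :* r :+ con (toℚ 4) :* ((c :+ c) :* (c :+ c))) refl r c)
    (cong (λ b → toℚ 16 ℚ.* (r ℚ.* r) ℚ.+ toℚ 16 ℚ.* b ℚ.* r ℚ.+ toℚ 4 ℚ.* (b ℚ.* b)) (half+half B))

  16br<K : toℚ 16 ℚ.* b ℚ.* r ℚ.< toℚ K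
  16br<K = square-cancel-< (0≤toℚ K) (begin-strict
    (toℚ 16 ℚ.* b ℚ.* r) ℚ.* (toℚ 16 ℚ.* b ℚ.* r)   ≡⟨ solve 2 (λ b r → (con (toℚ 16) :* b :* r) :* (con (toℚ 16) :* b :* r)
                                                               := con (toℚ 256) :* (b :* b) :* (r :* r)) refl b r ⟩
    toℚ 256 ℚ.* (b ℚ.* b) ℚ.* (r ℚ.* r)             ≡⟨ cong (ℚ._* (r ℚ.* r)) 256b² ⟨
    toℚ (256 * (B * B)) ℚ.* (r ℚ.* r)               ≤⟨ ℚₚ.*-monoˡ-≤-nonNeg (toℚ (256 * (B * B))) {{ℚ.nonNegative (0≤toℚ (256 * (B * B)))}} (ℚₚ.<⇒≤ r²<q) ⟩
    toℚ (256 * (B * B)) ℚ.* toℚ q                   ≡⟨ toℚ-* (256 * (B * B)) q ⟨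
    toℚ (256 * (B * B) * q)                         <⟨ toℚ-mono-< 256B²q<K² ⟩
    toℚ (K * K)                                     ≡⟨ toℚ-* K K ⟩
    toℚ K ℚ.* toℚ K                                 ∎)
    where
    256b² : toℚ (256 * (B * B)) ≡ toℚ 256 ℚ.* (b ℚ.* b)
    256b² = trans (toℚ-* 256 (B * B)) (cong (toℚ 256 ℚ.*_) (toℚ-* B B))

  cast : toℚ (16 * q + K + 4 * (B * B)) ≡ toℚ 16 ℚ.* toℚ q ℚ.+ toℚ K ℚ.+ toℚ 4 ℚ.* (b ℚ.* b)
  cast = trans (toℚ-+ (16 * q + K) (4 * (B * B))) (cong₂ ℚ._+_
    (trans (toℚ-+ (16 * q) K) (cong (ℚ._+ toℚ K) (toℚ-* 16 q)))
    (trans (toℚ-* 4 (B * B)) (cong (toℚ 4 ℚ.*_) (toℚ-* B B))))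

-- The bracket index is written k = 8 + e, so that the inequalities below hold for every e
-- and their polynomial steps are ring identities.
64*≤cube : ∀ {a} e → 4 * a ≤ 8 + e → 64 * a ≤ cubeℕ (6 + e)
64*≤cube {a} e 4a≤8+e = begin
  64 * a                                             ≡⟨ solve 1 (λ a → con 64 :* a := con 16 :* (con 4 :* a)) refl a ⟩
  16 * (4 * a)                                       ≤⟨ ℕₚ.*-monoʳ-≤ 16 4a≤8+e ⟩
  16 * (8 + e)                                       ≤⟨ ℕₚ.m≤m+n _ (e * e * e + 18 * (e * e) + 92 * e + 88) ⟩
  16 * (8 + e) + (e * e * e + 18 * (e * e) + 92 * e + 88)
    ≡⟨ solve 1 (λ e → con 16 :* (con 8 :+ e) :+ (e :* e :* e :+ con 18 :* (e :* e) :+ con 92 :* e :+ con 88)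
                    := (con 6 :+ e) :* (con 6 :+ e) :* (con 6 :+ e)) refl e ⟩
  cubeℕ (6 + e)                                      ∎
  where
  open ℕₚ.≤-Reasoning
  open +-*-Solver

256*<fourth-power : ∀ {B q} e → 4 * (B * B) < 8 + e → 64 * q ≤ cubeℕ (6 + e) →
  256 * (B * B) * q < (8 + e) * (8 + e) * ((8 + e) * (8 + e))
256*<fourth-power {B} {q} e 4B²<8+e 64q≤[6+e]³ = begin-strict
  256 * (B * B) * q           ≡⟨ solve 2 (λ b q → con 256 :* (b :* b) :* q := (con 4 :* (b :* b)) :* (con 64 :* q)) refl B q ⟩
  4 * (B * B) * (64 * q)      ≤⟨ ℕₚ.*-monoʳ-≤ (4 * (B * B)) 64q≤[6+e]³ ⟩
  4 * (B * B) * cubeℕ (6 + e) <⟨ ℕₚ.*-monoˡ-< (cubeℕ (6 + e)) 4B²<8+e ⟩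
  (8 + e) * cubeℕ (6 + e)     ≤⟨ ℕₚ.*-monoʳ-≤ (8 + e) (ℕₚ.*-mono-≤ (ℕₚ.*-mono-≤ 6+e≤8+e 6+e≤8+e) 6+e≤8+e) ⟩
  (8 + e) * cubeℕ (8 + e)     ≡⟨ solve 1 (λ k → k :* (k :* k :* k) := k :* k :* (k :* k)) refl (8 + e) ⟩
  (8 + e) * (8 + e) * ((8 + e) * (8 + e)) ∎
  where
  open ℕₚ.≤-Reasoning
  open +-*-Solver
  6+e≤8+e : 6 + e ≤ 8 + e
  6+e≤8+e = ℕₚ.m≤n+m (6 + e) 2

64*<cube : ∀ {B p q} e → 4 * (B * B) < 8 + e → 64 * q ≤ cubeℕ (6 + e) →
  16 * p < 16 * q + (8 + e) * (8 + e) + 4 * (B * B) → 64 * p < cubeℕ (8 + e)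
64*<cube {B} {p} {q} e 4B²<8+e 64q≤[6+e]³ 16p<16q+K+4B² = begin-strict
  64 * p                                      ≡⟨ solve 1 (λ p → con 64 :* p := con 4 :* (con 16 :* p)) refl p ⟩
  4 * (16 * p)                                <⟨ ℕₚ.*-monoʳ-< 4 16p<16q+K+4B² ⟩
  4 * (16 * q + K + 4 * (B * B))              ≡⟨ solve 3 (λ q K b² → con 4 :* (con 16 :* q :+ K :+ con 4 :* b²)
                                                                := con 64 :* q :+ con 4 :* K :+ con 4 :* (con 4 :* b²)) refl q K (B * B) ⟩
  64 * q + 4 * K + 4 * (4 * (B * B))          ≤⟨ ℕₚ.+-mono-≤ (ℕₚ.+-monoˡ-≤ (4 * K) 64q≤[6+e]³) (ℕₚ.*-monoʳ-≤ 4 (ℕₚ.<⇒≤ 4B²<8+e)) ⟩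
  cubeℕ (6 + e) + 4 * K + 4 * (8 + e)         ≤⟨ ℕₚ.m≤m+n _ (2 * (e * e) + 16 * e + 8) ⟩
  cubeℕ (6 + e) + 4 * K + 4 * (8 + e) + (2 * (e * e) + 16 * e + 8)
    ≡⟨ solve 1 (λ e → (con 6 :+ e) :* (con 6 :+ e) :* (con 6 :+ e) :+ con 4 :* ((con 8 :+ e) :* (con 8 :+ e))
                        :+ con 4 :* (con 8 :+ e) :+ (con 2 :* (e :* e) :+ con 16 :* e :+ con 8)
                   := (con 8 :+ e) :* (con 8 :+ e) :* (con 8 :+ e)) refl e ⟩
  cubeℕ (8 + e)                               ∎
  where
  open ℕₚ.≤-Reasoning
  open +-*-Solver
  K : ℕ
  K = (8 + e) * (8 + e)

SqrtGapsAfter : ℕ → ℚ → Set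
SqrtGapsAfter A c = ∀ n → A < n → ∀ q p → IsNthPrime (n ∸ 1) q → IsNthPrime n p → SqrtDiffLt p q c

prime-between-cubes : ∀ {A B pA} e → IsNthPrime A pA → B * B < pA → SqrtGapsAfter A ((+ B) / 2) →
  4 * pA ≤ 8 + e → Σ ℕ λ p → Prime p × cubeℕ (6 + e) < 64 * p × 64 * p < cubeℕ (8 + e)
prime-between-cubes {B = B} {pA} e (prime-pA , refl) B²<pA gaps 4pA≤8+e =
  let q , p , prime-q , prime-p , pA≤q , 64q≤[6+e]³ , [6+e]³<64p , p-after-q =
        consecutive-primes-around-multiple 64 prime-pA (64*≤cube {pA} e 4pA≤8+e)
      √p-√q<B/2 = gaps (primeCount p) (subst (primeCount pA <_) (sym p-after-q) (s≤s (primeCount-mono pA≤q)))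
                       q p (prime-q , sym (cong (_∸ 1) p-after-q)) (prime-p , refl)
  in  p , prime-p , [6+e]³<64p
    , 64*<cube {B} {p} {q} e 4B²<8+e 64q≤[6+e]³
        (SqrtDiffLt⇒bound {p} {q} {B} {(8 + e) * (8 + e)} √p-√q<B/2 (256*<fourth-power {B} {q} e 4B²<8+e 64q≤[6+e]³))
  where
  4B²<8+e : 4 * (B * B) < 8 + e
  4B²<8+e = ℕₚ.<-≤-trans (ℕₚ.*-monoʳ-< 4 B²<pA) 4pA≤8+e

theorem8 : (A B : ℕ) → 1 ≤ A → 4 ≤ B →
    (pA : ℕ) → IsNthPrime A pA → B * B < pA →
    (∀ n → A < n → ∀ q p → IsNthPrime (n ∸ 1) q → IsNthPrime n p →
      SqrtDiffLt p q ((+ B) / 2)) →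
    (x : ℝ) → toℚ pA <ʳ x →
    Σ ℕ λ p → Prime p × (cubeOfPred x < toℚ p) × (toℚ p <cubeOf x)
theorem8 A B _ _ pA pA-is-Ath@(prime-pA , _) B²<pA gaps x pA<x
  with quarter-bracket x (subst (_<ʳ x) (sym (quarter-4* pA)) pA<x)
... | k , 4pA≤k , k<x , x<2+k with ℕₚ.m≤n⇒∃[o]m+o≡n {8} (ℕₚ.≤-trans (8≤4*prime prime-pA) 4pA≤k)
... | e , refl with prime-between-cubes {A} {B} {pA} e pA-is-Ath B²<pA gaps 4pA≤k
... | p , prime-p , lower , upper = p , prime-p , cubes-around {6 + e} {p} x x<2+k k<x lower upper
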